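{- There does not exist any function $f:\mathbb{N}\to\mathbb{N}$ such that, for every digraph $D$, $\operatorname{bw}(u(D))\leq f(\operatorname{dbw}(D))$.
   Context: All digraphs are finite; $u(D)$ is the underlying undirected graph of $D$, obtained by forgetting edge directions. Branch-width: a branch decomposition of an undirected graph $G$ is a pair $(T,\tau)$ with $T$ a tree of maximum degree at most three and $\tau$ a bijection from the leaves of $T$ to $E(G)$. The order of an edge $e$ of $T$ is the number of vertices $v$ of $G$ for which there are leaves $t_1,t_2$ in different components of $T-e$ with $\tau(t_1),\tau(t_2)$ both incident with $v$. The width is the maximum order of an edge of $T$, and $\operatorname{bw}(G)$ is the minimum width of a branch decomposition. Directed branch-width: for $B\subseteq E(D)$ let $S_B^V=\{y\in V(D): \exists x,z \text{ with } \vec{xy}\in E(D)\setminus B,\ \vec{yz}\in B\}$ and $f_D(X)=|S_X^V\cup S_{E(D)\setminus X}^V|$. A directed branch decomposition is a pair $(T,\beta)$ with $T$ a tree of maximum degree at most three and $\beta$ a bijection from the leaves of $T$ to $E(D)$. For an edge $xy$ of $T$, with $Y$ the set of leaves in the component of $T-xy$ containing $y$, its order is $f_D(\beta(Y))$. The width is the maximum order of an edge, and $\operatorname{dbw}(D)$ is the minimum width. -}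

module Defs where

open import Data.Nat using (ℕ; zero; suc; _≤_; _<_)
open import Data.Fin using (Fin; zero; suc; inject₁; fromℕ)
open import Data.Fin.Subset using (Subset; _∈_; ∣_∣)
open import Data.Vec using (tabulate)
open import Data.Bool using (Bool; true)
open import Data.Product using (Σ; ∃; _×_; _,_)
open import Data.Sum using (_⊎_)
open import Relation.Nullary using (¬_)
open import Relation.Binary.PropositionalEquality using (_≡_; _≢_)
open import Relation.Binary.Construct.Closure.ReflexiveTransitive using (Star)
open import Function.Definitions using (Injective)

record Digraph : Set where
  field
    n     : ℕ
    m     : ℕ
    tail  : Fin m → Fin n
    head  : Fin m → Fin n
    loopless   : ∀ e → tail e ≢ head e
    noParallel : ∀ e e' → tail e ≡ tail e' → head e ≡ head e' → e ≡ e'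

record Graph : Set where
  field
    n    : ℕ
    m    : ℕ
    end₁ : Fin m → Fin n
    end₂ : Fin m → Fin n

  Inc : Fin m → Fin n → Set
  Inc e v = (end₁ e ≡ v) ⊎ (end₂ e ≡ v)

u : Digraph → Graph
u D = record { n = Digraph.n D ; m = Digraph.m D
             ; end₁ = Digraph.tail D ; end₂ = Digraph.head D }

record Tree : Set where
  field
    k      : ℕ
    adj    : Fin k → Fin k → Bool
    adj-sym    : ∀ x y → adj x y ≡ adj y x
    adj-irrefl : ∀ x → ¬ (adj x x ≡ true)

  Adj : Fin k → Fin k → Set
  Adj x y = adj x y ≡ true

  deg : Fin k → ℕ
  deg x = ∣ tabulate (adj x) ∣

  IsCycle : (ℓ : ℕ) → (Fin (suc (suc (suc ℓ))) → Fin k) → Set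
  IsCycle ℓ c = Injective _≡_ _≡_ c
              × (∀ (i : Fin (suc (suc ℓ))) → Adj (c (inject₁ i)) (c (suc i)))
              × Adj (c (fromℕ (suc (suc ℓ)))) (c zero)

  field
    connected : ∀ x y → Star Adj x y
    acyclic   : ∀ ℓ c → ¬ IsCycle ℓ c
    maxDeg≤3  : ∀ x → deg x ≤ 3

  -- leaves (degree ≤ 1; degree 0 only occurs in the one-vertex tree)
  Leaf : Fin k → Set
  Leaf x = deg x ≤ 1

  AdjWithout : Fin k → Fin k → Fin k → Fin k → Set
  AdjWithout x y a b = Adj a b × ¬ (a ≡ x × b ≡ y) × ¬ (a ≡ y × b ≡ x)

  ReachWithout : Fin k → Fin k → Fin k → Fin k → Set
  ReachWithout x y = Star (AdjWithout x y)

record BranchDecomposition (G : Graph) : Set where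
  open Graph G
  field
    T : Tree
  open Tree T
  field
    τ : Fin k → Fin m
    τ-inj  : ∀ x y → Leaf x → Leaf y → τ x ≡ τ y → x ≡ y
    τ-surj : ∀ e → ∃ λ x → Leaf x × τ x ≡ e

  -- v is counted in the order of the tree edge xy
  Counted : Fin k → Fin k → Fin n → Set
  Counted x y v = ∃ λ t₁ → ∃ λ t₂ → Leaf t₁ × Leaf t₂
                × ¬ ReachWithout x y t₁ t₂
                × Inc (τ t₁) v × Inc (τ t₂) v

  WidthAtMost : ℕ → Set
  WidthAtMost w = ∀ x y → Adj x y →
    Σ (Subset n) λ S → (∀ v → Counted x y v → v ∈ S) × ∣ S ∣ ≤ w

BWAtMost : Graph → ℕ → Set
BWAtMost G w = Σ (BranchDecomposition G) λ B → BranchDecomposition.WidthAtMost B w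

IsBW : Graph → ℕ → Set
IsBW G w = BWAtMost G w × (∀ w' → w' < w → ¬ BWAtMost G w')

record DirBranchDecomposition (D : Digraph) : Set where
  open Digraph D
  field
    T : Tree
  open Tree T
  field
    β : Fin k → Fin m
    β-inj  : ∀ x y → Leaf x → Leaf y → β x ≡ β y → x ≡ y
    β-surj : ∀ e → ∃ λ x → Leaf x × β x ≡ e

  -- arc e ∈ β(Y), Y = leaves in the component of T - xy containing y
  InSide : Fin k → Fin k → Fin m → Set
  InSide x y e = ∃ λ t → Leaf t × ReachWithout x y y t × β t ≡ e

  -- S^V_B for B = β(Y) (given by membership predicate)
  SV : (Fin m → Set) → Fin n → Set
  SV B v = ∃ λ a → ∃ λ b → head a ≡ v × ¬ B a × tail b ≡ v × B b

  -- v ∈ S^V_{β(Y)} ∪ S^V_{E(D) ∖ β(Y)}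
  Counted : Fin k → Fin k → Fin n → Set
  Counted x y v = SV (InSide x y) v ⊎ SV (λ e → ¬ InSide x y e) v

  WidthAtMost : ℕ → Set
  WidthAtMost w = ∀ x y → Adj x y →
    Σ (Subset n) λ S → (∀ v → Counted x y v → v ∈ S) × ∣ S ∣ ≤ w

DBWAtMost : Digraph → ℕ → Set
DBWAtMost D w = Σ (DirBranchDecomposition D) λ B → DirBranchDecomposition.WidthAtMost B w

IsDBW : Digraph → ℕ → Set
IsDBW D w = DBWAtMost D w × (∀ w' → w' < w → ¬ DBWAtMost D w')

-- The biclique with all arcs directed from the left to the right side has no vertex that is both a
-- head and a tail, so every directed branch decomposition of it has width 0 (a caterpillar with one
-- leaf per arc provides one). Its underlying graph K_{N,N} with N = 3w + 2 has branch-width > w.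
-- Given a branch decomposition of width ≤ w, orient the tree edge xy towards y when some left vertex
-- outside the separator of xy is an end of an edge placed on y's side. Every tree node has an
-- out-edge, since its at most three separators have fewer than N vertices together and so miss a
-- left vertex; no edge is oriented both ways, since a right vertex outside the separator would
-- join the two sides. But following out-edges in a finite tree must end at a sink.

module Submission where

open import Data.Nat using (ℕ; zero; suc; _+_; _*_; _≤_; _<_; z≤n; s≤s; _≤?_)
import Data.Nat as ℕ
open import Data.Nat.Properties
  using (≤-trans; ≤-refl; ≤-reflexive; ≤-<-trans; n≮n; ≰⇒>; <⇒≤; suc-injective; m≢1+n+m; 1+n≢n;
         m<n⇒m<1+n; n<1+n; +-suc; +-mono-≤; *-monoˡ-≤; m≤n*m; m≤n⇒m≤1+n)
open import Data.Fin using (Fin; zero; suc; toℕ; inject₁; fromℕ; _↑ˡ_; _↑ʳ_; splitAt; join; combine; remQuot)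
open import Data.Fin.Properties
  using (injective⇒≤; ¬∀⟶∃¬; toℕ-inject₁; toℕ-injective; splitAt-↑ˡ; splitAt-↑ʳ; join-splitAt;
         ↑ˡ-injective; ↑ʳ-injective; combine-remQuot; remQuot-combine; combine-injective)
  renaming (_≟_ to _≟F_; suc-injective to Fin-suc-injective)
open import Data.Fin.Subset using (Subset; inside; outside; _∈_; _∉_; ∣_∣; _∪_; _⊆_) renaming (⊥ to ∅)
open import Data.Fin.Subset.Properties using (∣⊥∣≡0; x∈p∪q⁺; _∈?_)
open import Data.Vec using ([]; _∷_; here; there; tabulate)
open import Data.Vec.Properties using ([]=⇒lookup; lookup⇒[]=; lookup∘tabulate)
open import Data.Bool using (Bool; true; false)
open import Data.Bool.Properties using () renaming (_≟_ to _≟B_)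
open import Axiom.UniquenessOfIdentityProofs using (module Decidable⇒UIP)
open import Data.List using (List; []; _∷_; length; lookup)
open import Data.List.Relation.Unary.All using (All; []; _∷_)
open import Data.List.Relation.Unary.All.Properties using (¬Any⇒All¬)
import Data.List.Relation.Unary.All as All
open import Data.List.Membership.Propositional.Properties using (∈-lookup)
open import Data.List.Relation.Unary.Any using (here; there)
open import Data.List.Relation.Unary.AllPairs using ([]; _∷_)
open import Data.List.Relation.Unary.Unique.Propositional using (Unique)
import Data.List.Membership.Propositional as List
open import Data.Product using (Σ; ∃; _×_; _,_; proj₁; proj₂; uncurry)
open import Data.Product.Properties using (×-≡,≡→≡)
open import Data.Sum using (_⊎_; inj₁; inj₂; reduce)
open import Data.Empty using (⊥; ⊥-elim)
open import Function.Base using (case_of_)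
open import Function.Definitions using (Injective)
open import Relation.Nullary using (¬_; yes; no; Dec; does)
open import Relation.Nullary.Decidable using (dec-true)
open import Relation.Binary.PropositionalEquality using (_≡_; _≢_; refl; sym; trans; cong; subst; subst₂)
open import Relation.Binary.Construct.Closure.ReflexiveTransitive using (Star; ε; _◅_; _◅◅_)
import Relation.Binary.Construct.Closure.ReflexiveTransitive as Star

open import Defs

-- Counting in finite sets

rank : ∀ {n} (p : Subset n) (v : Fin n) → v ∈ p → Fin ∣ p ∣
rank (inside  ∷ p) zero    here      = zero
rank (inside  ∷ p) (suc v) (there q) = suc (rank p v q)
rank (outside ∷ p) (suc v) (there q) = rank p v q

rank-injective : ∀ {n} (p : Subset n) (v v′ : Fin n) (q : v ∈ p) (q′ : v′ ∈ p) →
                 rank p v q ≡ rank p v′ q′ → v ≡ v′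
rank-injective (inside  ∷ p) zero    zero     here      here       _  = refl
rank-injective (inside  ∷ p) zero    (suc v′) here      (there q′) ()
rank-injective (inside  ∷ p) (suc v) zero     (there q) here       ()
rank-injective (inside  ∷ p) (suc v) (suc v′) (there q) (there q′) eq =
  cong suc (rank-injective p v v′ q q′ (Fin-suc-injective eq))
rank-injective (outside ∷ p) (suc v) (suc v′) (there q) (there q′) eq =
  cong suc (rank-injective p v v′ q q′ eq)

unrank : ∀ {n} (p : Subset n) → Fin ∣ p ∣ → Fin n
unrank (inside  ∷ p) zero    = zero
unrank (inside  ∷ p) (suc i) = suc (unrank p i)
unrank (outside ∷ p) i       = suc (unrank p i)

unrank-∈ : ∀ {n} (p : Subset n) (i : Fin ∣ p ∣) → unrank p i ∈ p
unrank-∈ (inside  ∷ p) zero    = here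
unrank-∈ (inside  ∷ p) (suc i) = there (unrank-∈ p i)
unrank-∈ (outside ∷ p) i       = there (unrank-∈ p i)

unrank-injective : ∀ {n} (p : Subset n) → Injective _≡_ _≡_ (unrank p)
unrank-injective (inside  ∷ p) {zero}  {zero}  _  = refl
unrank-injective (inside  ∷ p) {suc i} {suc j} eq = cong suc (unrank-injective p (Fin-suc-injective eq))
unrank-injective (outside ∷ p) eq = unrank-injective p (Fin-suc-injective eq)

injection-into⇒≤∣p∣ : ∀ {n j} (p : Subset n) (f : Fin j → Fin n) → Injective _≡_ _≡_ f →
                      (∀ i → f i ∈ p) → j ≤ ∣ p ∣
injection-into⇒≤∣p∣ p f f-injective f∈p =
  injective⇒≤ {f = λ i → rank p (f i) (f∈p i)} λ eq → f-injective (rank-injective p _ _ _ _ eq)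

∣p∣<⇒∃∉ : ∀ {n N} (p : Subset n) (f : Fin N → Fin n) → Injective _≡_ _≡_ f → ∣ p ∣ < N →
          ∃ λ i → f i ∉ p
∣p∣<⇒∃∉ {N = N} p f f-injective ∣p∣<N = ¬∀⟶∃¬ N (λ i → f i ∈ p) (λ i → f i ∈? p)
  λ all∈ → n≮n N (≤-<-trans (injection-into⇒≤∣p∣ p f f-injective all∈) ∣p∣<N)

injection-from⇒∣p∣≤ : ∀ {n j} (p : Subset n) (h : ∀ v → v ∈ p → Fin j) →
                      (∀ {v v′} q q′ → h v q ≡ h v′ q′ → v ≡ v′) → ∣ p ∣ ≤ j
injection-from⇒∣p∣≤ p h h-injective =
  injective⇒≤ {f = λ i → h (unrank p i) (unrank-∈ p i)} λ eq → unrank-injective p (h-injective _ _ eq)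

∣p∪q∣≤∣p∣+∣q∣ : ∀ {n} (p q : Subset n) → ∣ p ∪ q ∣ ≤ ∣ p ∣ + ∣ q ∣
∣p∪q∣≤∣p∣+∣q∣ []            []            = z≤n
∣p∪q∣≤∣p∣+∣q∣ (inside  ∷ p) (inside  ∷ q) =
  s≤s (≤-trans (m≤n⇒m≤1+n (∣p∪q∣≤∣p∣+∣q∣ p q)) (≤-reflexive (sym (+-suc _ _))))
∣p∪q∣≤∣p∣+∣q∣ (inside  ∷ p) (outside ∷ q) = s≤s (∣p∪q∣≤∣p∣+∣q∣ p q)
∣p∪q∣≤∣p∣+∣q∣ (outside ∷ p) (inside  ∷ q) =
  ≤-trans (s≤s (∣p∪q∣≤∣p∣+∣q∣ p q)) (≤-reflexive (sym (+-suc _ _)))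
∣p∪q∣≤∣p∣+∣q∣ (outside ∷ p) (outside ∷ q) = ∣p∪q∣≤∣p∣+∣q∣ p q

∈-tabulate⁺ : ∀ {n} (f : Fin n → Bool) {z} → f z ≡ true → z ∈ tabulate f
∈-tabulate⁺ f {z} fz = lookup⇒[]= z (tabulate f) (trans (lookup∘tabulate f z) fz)

∈-tabulate⁻ : ∀ {n} (f : Fin n → Bool) {z} → z ∈ tabulate f → f z ≡ true
∈-tabulate⁻ f {z} z∈ = trans (sym (lookup∘tabulate f z)) ([]=⇒lookup z∈)

⋃[_]_ : ∀ {k n} → Subset k → (Fin k → Subset n) → Subset n
⋃[ []          ] F = ∅
⋃[ inside  ∷ P ] F = F zero ∪ ⋃[ P ] (λ z → F (suc z))
⋃[ outside ∷ P ] F = ⋃[ P ] (λ z → F (suc z))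

∣⋃∣≤ : ∀ {k n} w (P : Subset k) (F : Fin k → Subset n) → (∀ z → ∣ F z ∣ ≤ w) →
       ∣ ⋃[ P ] F ∣ ≤ ∣ P ∣ * w
∣⋃∣≤ {n = n} w []            F _      = ≤-reflexive (∣⊥∣≡0 n)
∣⋃∣≤         w (inside  ∷ P) F ∣F∣≤w =
  ≤-trans (∣p∪q∣≤∣p∣+∣q∣ (F zero) _) (+-mono-≤ (∣F∣≤w zero) (∣⋃∣≤ w P _ (λ z → ∣F∣≤w (suc z))))
∣⋃∣≤         w (outside ∷ P) F ∣F∣≤w = ∣⋃∣≤ w P _ (λ z → ∣F∣≤w (suc z))

∈-⋃ : ∀ {k n} (P : Subset k) (F : Fin k → Subset n) {z v} → z ∈ P → v ∈ F z → v ∈ ⋃[ P ] F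
∈-⋃ (inside  ∷ P) F here       v∈ = x∈p∪q⁺ (inj₁ v∈)
∈-⋃ (inside  ∷ P) F (there z∈) v∈ = x∈p∪q⁺ {p = F zero} (inj₂ (∈-⋃ P _ z∈ v∈))
∈-⋃ (outside ∷ P) F (there z∈) v∈ = ∈-⋃ P _ z∈ v∈

lookup-injective : ∀ {A : Set} {xs : List A} → Unique xs → Injective _≡_ _≡_ (lookup xs)
lookup-injective {xs = _ ∷ _} (_    ∷ _)      {zero}  {zero}  _  = refl
lookup-injective {xs = _ ∷ _} (x∉xs ∷ _)      {zero}  {suc j} eq = ⊥-elim (All.lookup x∉xs (∈-lookup j) eq)
lookup-injective {xs = _ ∷ _} (x∉xs ∷ _)      {suc i} {zero}  eq = ⊥-elim (All.lookup x∉xs (∈-lookup i) (sym eq))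
lookup-injective {xs = _ ∷ _} (_    ∷ unique) {suc i} {suc j} eq = cong suc (lookup-injective unique eq)

unique⇒length≤ : ∀ {k} {xs : List (Fin k)} → Unique xs → length xs ≤ k
unique⇒length≤ unique = injective⇒≤ (lookup-injective unique)

-- Trees

module TreeProperties (T : Tree) where
  open Tree T
  open import Data.List.Membership.DecPropositional (_≟F_ {k}) renaming (_∈?_ to _∈?ᴸ_)

  Adj-sym : ∀ {a b} → Adj a b → Adj b a
  Adj-sym {a} {b} ab = trans (adj-sym b a) ab

  Adj⇒≢ : ∀ {a b} → Adj a b → a ≢ b
  Adj⇒≢ {a} aa refl = adj-irrefl a aa

  lastOf : Fin k → List (Fin k) → Fin k
  lastOf a []       = a
  lastOf a (b ∷ xs) = lastOf b xs

  data Chain (R : Fin k → Fin k → Set) : Fin k → List (Fin k) → Set where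
    []  : ∀ {a} → Chain R a []
    _∷_ : ∀ {a b xs} → R a b → Chain R b xs → Chain R a (b ∷ xs)

  Chain-map : ∀ {R R′ : Fin k → Fin k → Set} → (∀ {a b} → R a b → R′ a b) →
              ∀ {a xs} → Chain R a xs → Chain R′ a xs
  Chain-map f []      = []
  Chain-map f (r ∷ c) = f r ∷ Chain-map f c

  SimpleChain : (Fin k → Fin k → Set) → Fin k → Fin k → Set
  SimpleChain R a b = Σ (List (Fin k)) λ xs → Unique (a ∷ xs) × Chain R a xs × lastOf a xs ≡ b

  Chain-lookup : ∀ {a xs} → Chain Adj a xs → ∀ (i : Fin (length xs)) →
                 Adj (lookup (a ∷ xs) (inject₁ i)) (lookup (a ∷ xs) (suc i))
  Chain-lookup (r ∷ c) zero    = r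
  Chain-lookup (r ∷ c) (suc i) = Chain-lookup c i

  lookup-last : ∀ a xs → lookup (a ∷ xs) (fromℕ (length xs)) ≡ lastOf a xs
  lookup-last a []       = refl
  lookup-last a (b ∷ xs) = lookup-last b xs

  no-closed-chain : ∀ {a xs} → Unique (a ∷ xs) → Chain Adj a xs → Adj (lastOf a xs) a →
                    2 ≤ length xs → ⊥
  no-closed-chain {a} {xs@(_ ∷ _ ∷ rest)} unique chain closing _ =
    acyclic (length rest) (lookup (a ∷ xs))
      ( lookup-injective unique
      , Chain-lookup chain
      , subst (λ v → Adj v a) (sym (lookup-last a xs)) closing )
  no-closed-chain {xs = _ ∷ []} _ _ _ (s≤s ())

  suffix-from : ∀ {R a a₀ xs₀} → Unique (a₀ ∷ xs₀) → Chain R a₀ xs₀ → a List.∈ (a₀ ∷ xs₀) →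
                SimpleChain R a (lastOf a₀ xs₀)
  suffix-from {xs₀ = xs₀} unique chain (here refl) = xs₀ , unique , chain , refl
  suffix-from (_ ∷ unique) (_ ∷ chain) (there a∈) = suffix-from unique chain a∈

  Star⇒SimpleChain : ∀ {R a b} → Star R a b → SimpleChain R a b
  Star⇒SimpleChain ε = [] , ([] ∷ []) , [] , refl
  Star⇒SimpleChain {a = a} (_◅_ {j = a₁} r rs) with Star⇒SimpleChain rs
  ... | xs , unique , chain , ends with a ∈?ᴸ (a₁ ∷ xs)
  ...   | yes a∈ = let (ys , unique′ , chain′ , ends′) = suffix-from unique chain a∈
                   in ys , unique′ , chain′ , trans ends′ ends
  ...   | no a∉  = (a₁ ∷ xs) , (¬Any⇒All¬ _ a∉ ∷ unique) , (r ∷ chain) , ends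

  edge-is-bridge : ∀ {x y} → Adj x y → ¬ ReachWithout x y x y
  edge-is-bridge {x} xy path with Star⇒SimpleChain path
  ... | []               , _      , _            , ends = Adj⇒≢ xy ends
  ... | (_ ∷ [])         , _      , (step ∷ [])  , ends = proj₁ (proj₂ step) (refl , ends)
  ... | (_ ∷ _ ∷ _)      , unique , chain        , ends =
    no-closed-chain unique (Chain-map proj₁ chain) (subst (λ v → Adj v x) (sym ends) (Adj-sym xy))
      (s≤s (s≤s z≤n))

  ReachWithout-reverse : ∀ {x y a b} → ReachWithout x y a b → ReachWithout x y b a
  ReachWithout-reverse = Star.reverse λ (ab , ≢xy , ≢yx) →
    Adj-sym ab , (λ (b≡x , a≡y) → ≢yx (a≡y , b≡x)) , (λ (b≡y , a≡x) → ≢xy (a≡x , b≡y))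

  ReachWithout-flip : ∀ {x y a b} → ReachWithout y x a b → ReachWithout x y a b
  ReachWithout-flip = Star.map λ (ab , ≢yx , ≢xy) → ab , ≢xy , ≢yx

  -- z is the neighbour through which a walk from t first enters y.
  in-some-branch : ∀ t y → t ≢ y → ∃ λ z → Adj y z × ReachWithout y z z t
  in-some-branch t y t≢y = go t t≢y (connected t y)
    where
    go : ∀ t → t ≢ y → Star Adj t y → ∃ λ z → Adj y z × ReachWithout y z z t
    go t t≢y ε = ⊥-elim (t≢y refl)
    go t t≢y (_◅_ {j = t₁} tt₁ walk) with t₁ ≟F y
    ... | yes refl = t , Adj-sym tt₁ , ε
    ... | no t₁≢y  =
      let (z , yz , z⇝t₁) = go t₁ t₁≢y walk
      in z , yz , (z⇝t₁ ◅◅ ((Adj-sym tt₁ , (λ (t₁≡y , _) → t₁≢y t₁≡y) , (λ (_ , t≡y) → t≢y t≡y))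
                             ◅ ε))

  prefix-to : ∀ {z h xs} → Unique (h ∷ xs) → Chain Adj h xs → z List.∈ xs →
              Σ (List (Fin k)) λ ys → Unique (h ∷ ys) × Chain Adj h ys × lastOf h ys ≡ z × 1 ≤ length ys
                × (∀ {P : Fin k → Set} → All P xs → All P ys)
  prefix-to ((h∉ ∷ _) ∷ _) (r ∷ _) (here refl) =
    (_ ∷ []) , ((h∉ ∷ []) ∷ ([] ∷ [])) , (r ∷ []) , refl , s≤s z≤n , λ { (p ∷ _) → p ∷ [] }
  prefix-to ((h∉ ∷ h∉s) ∷ unique) (r ∷ chain) (there z∈) =
    let (ys , unique′ , chain′ , ends , _ , restrict) = prefix-to unique chain z∈
    in (_ ∷ ys) , ((h∉ ∷ restrict h∉s) ∷ unique′) , (r ∷ chain′) , ends , s≤s z≤n ,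
       λ { (p ∷ ps) → p ∷ restrict ps }

  -- Following out-edges never turns back (asymmetry) and never closes a cycle, so it would
  -- trace simple paths longer than the tree.
  no-sinkless-orientation : (Out : Fin k → Fin k → Set) → (∀ {x y} → Out x y → Adj x y) →
                            (∀ {x y} → Out x y → Out y x → ⊥) → (∀ y → ¬ (∀ z → ¬ Out y z)) →
                            Fin k → ⊥
  no-sinkless-orientation Out Out⇒Adj Out-asym sinkless start = path-of-length (suc k) too-long
    where
    OutPath : ℕ → Set
    OutPath L = Σ (Fin k) λ y → Σ (Fin k) λ x → Σ (List (Fin k)) λ rest →
      Unique (y ∷ x ∷ rest) × Chain Adj y (x ∷ rest) × Out x y × L ≤ length rest

    extend : ∀ {L y x rest} → Unique (y ∷ x ∷ rest) → Chain Adj y (x ∷ rest) → L ≤ length rest →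
             ∀ {z} → Out y z → z ≢ y → z ≢ x → Dec (z List.∈ rest) → ¬ ¬ OutPath (suc L)
    extend ((y∉ ∷ y∉rest) ∷ unique) (yx ∷ chain) _ yz _ _ (yes z∈) _ =
      let (ys , unique′ , chain′ , ends , 1≤ys , restrict) = prefix-to unique chain z∈
      in no-closed-chain ((y∉ ∷ restrict y∉rest) ∷ unique′) (yx ∷ chain′)
           (subst (λ v → Adj v _) (sym ends) (Adj-sym (Out⇒Adj yz))) (s≤s 1≤ys)
    extend unique chain L≤ yz z≢y z≢x (no z∉) longer =
      longer (_ , _ , _ ∷ _ , ((z≢y ∷ z≢x ∷ ¬Any⇒All¬ _ z∉) ∷ unique) , (Adj-sym (Out⇒Adj yz) ∷ chain) ,
              yz , s≤s L≤)

    path-of-length : ∀ L → ¬ ¬ OutPath L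
    path-of-length zero    long = sinkless start λ z sz →
      long (z , start , [] , (((λ z≡s → Adj⇒≢ (Out⇒Adj sz) (sym z≡s)) ∷ []) ∷ ([] ∷ [])) ,
            (Adj-sym (Out⇒Adj sz) ∷ []) , sz , z≤n)
    path-of-length (suc L) long = path-of-length L λ (y , x , rest , unique , chain , xy , L≤) →
      sinkless y λ z yz →
        extend unique chain L≤ yz (λ z≡y → Adj⇒≢ (Out⇒Adj yz) (sym z≡y))
          (λ { refl → Out-asym xy yz }) (z ∈?ᴸ rest) long

    too-long : ¬ OutPath (suc k)
    too-long (y , x , rest , unique , _ , _ , k<rest) =
      n≮n k (≤-trans k<rest (≤-trans (m≤n⇒m≤1+n (m≤n⇒m≤1+n ≤-refl)) (unique⇒length≤ unique)))

-- Caterpillars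

argmax : ∀ {n} (g : Fin (suc n) → ℕ) → ∃ λ i → ∀ j → g j ≤ g i
argmax {zero}  g = zero , λ { zero → ≤-refl }
argmax {suc n} g with argmax (λ j → g (suc j))
... | i , max with g zero ≤? g (suc i)
...   | yes g0≤ = suc i , λ { zero → g0≤ ; (suc j) → max j }
...   | no  g0≰ = zero  , λ { zero → ≤-refl ; (suc j) → ≤-trans (max j) (<⇒≤ (≰⇒> g0≰)) }

fromℕ-or-inject₁ : ∀ n (j : Fin (suc n)) → j ≡ fromℕ n ⊎ ∃ λ j′ → j ≡ inject₁ j′
fromℕ-or-inject₁ zero    zero    = inj₁ refl
fromℕ-or-inject₁ (suc n) zero    = inj₂ (zero , refl)
fromℕ-or-inject₁ (suc n) (suc j) with fromℕ-or-inject₁ n j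
... | inj₁ refl         = inj₁ refl
... | inj₂ (j′ , refl)  = inj₂ (suc j′ , refl)

cycle-neighbours : ∀ {V : Set} (R : V → V → Set) ℓ (c : Fin (suc (suc (suc ℓ))) → V) →
                   (∀ i → R (c (inject₁ i)) (c (suc i))) → R (c (fromℕ (suc (suc ℓ)))) (c zero) →
                   ∀ i → ∃ λ p → ∃ λ q → p ≢ q × R (c p) (c i) × R (c i) (c q)
cycle-neighbours R ℓ c step closing zero = fromℕ (suc (suc ℓ)) , suc zero , (λ ()) , closing , step zero
cycle-neighbours R ℓ c step closing (suc j) with fromℕ-or-inject₁ (suc ℓ) j
... | inj₁ refl        = inject₁ (fromℕ (suc ℓ)) , zero , (λ ()) , step (fromℕ (suc ℓ)) , closing
... | inj₂ (j′ , refl) =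
  inject₁ (inject₁ j′) , suc (suc j′) , ≢suc-suc , step (inject₁ j′) , step (suc j′)
  where
  ≢suc-suc : inject₁ (inject₁ j′) ≢ suc (suc j′)
  ≢suc-suc eq = m≢1+n+m (toℕ j′)
    (trans (sym (trans (toℕ-inject₁ (inject₁ j′)) (toℕ-inject₁ j′))) (cong toℕ eq))

module ParentGraph {V : Set} (Parent : V → V → Set) (depth : V → ℕ)
  (depth-Parent : ∀ {x y} → Parent x y → depth x ≡ suc (depth y))
  (Parent-unique : ∀ {x y y′} → Parent x y → Parent x y′ → y ≡ y′) where

  data Linked (x y : V) : Set where
    to-parent : Parent x y → Linked x y
    to-child  : Parent y x → Linked x y

  Linked-sym : ∀ {x y} → Linked x y → Linked y x
  Linked-sym (to-parent xy) = to-child xy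
  Linked-sym (to-child yx)  = to-parent yx

  Linked-irrefl : ∀ x → ¬ Linked x x
  Linked-irrefl x (to-parent xx) = 1+n≢n (sym (depth-Parent xx))
  Linked-irrefl x (to-child xx)  = 1+n≢n (sym (depth-Parent xx))

  Linked⇒Parent : ∀ {x v} → depth v ≤ depth x → Linked x v → Parent x v
  Linked⇒Parent _   (to-parent xv) = xv
  Linked⇒Parent {x} v≤x (to-child vx) = ⊥-elim (n≮n (depth x) (subst (_≤ depth x) (depth-Parent vx) v≤x))

  -- A deepest vertex of a cycle would have both of its cycle neighbours as parent.
  no-cycle : ∀ ℓ (c : Fin (suc (suc (suc ℓ))) → V) → Injective _≡_ _≡_ c →
             (∀ i → Linked (c (inject₁ i)) (c (suc i))) → Linked (c (fromℕ (suc (suc ℓ)))) (c zero) → ⊥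
  no-cycle ℓ c c-injective step closing with argmax (λ i → depth (c i))
  ... | i , deepest with cycle-neighbours Linked ℓ c step closing i
  ...   | p , q , p≢q , pi , iq = p≢q (c-injective (Parent-unique
            (Linked⇒Parent (deepest p) (Linked-sym pi)) (Linked⇒Parent (deepest q) iq)))

-- The spine i ↑ˡ M is a path rooted at 0 and the pendant M ↑ʳ j hangs off spine vertex j. As M ≥ 2, every
-- spine vertex has degree at least 2, so the leaves are exactly the pendants.
module Caterpillar (M′ : ℕ) where
  M : ℕ
  M = suc (suc M′)

  V : Set
  V = Fin (M + M)

  spine pendant : Fin M → V
  spine   i = i ↑ˡ M
  pendant j = M ↑ʳ j

  view : V → Fin M ⊎ Fin M
  view = splitAt M

  view-injective : Injective _≡_ _≡_ view
  view-injective {x} {y} eq = trans (sym (join-splitAt M M x)) (trans (cong (join M M) eq) (join-splitAt M M y))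

  view-spine : ∀ i → view (spine i) ≡ inj₁ i
  view-spine i = splitAt-↑ˡ M i M

  view-pendant : ∀ j → view (pendant j) ≡ inj₂ j
  view-pendant j = splitAt-↑ʳ M M j

  ParentOf : Fin M ⊎ Fin M → Fin M ⊎ Fin M → Set
  ParentOf (inj₁ i) (inj₁ j) = suc (toℕ j) ≡ toℕ i
  ParentOf (inj₂ i) (inj₁ j) = i ≡ j
  ParentOf _        (inj₂ _) = ⊥

  ParentOf? : ∀ s t → Dec (ParentOf s t)
  ParentOf? (inj₁ i) (inj₁ j) = suc (toℕ j) ℕ.≟ toℕ i
  ParentOf? (inj₂ i) (inj₁ j) = i ≟F j
  ParentOf? (inj₁ _) (inj₂ _) = no λ ()
  ParentOf? (inj₂ _) (inj₂ _) = no λ ()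

  depthOf : Fin M ⊎ Fin M → ℕ
  depthOf (inj₁ i) = toℕ i
  depthOf (inj₂ j) = suc (toℕ j)

  depthOf-ParentOf : ∀ s t → ParentOf s t → depthOf s ≡ suc (depthOf t)
  depthOf-ParentOf (inj₁ i) (inj₁ j) eq = sym eq
  depthOf-ParentOf (inj₂ i) (inj₁ j) eq = cong (λ j → suc (toℕ j)) eq

  ParentOf-unique : ∀ s t t′ → ParentOf s t → ParentOf s t′ → t ≡ t′
  ParentOf-unique (inj₁ i) (inj₁ j) (inj₁ j′) eq eq′ =
    cong inj₁ (toℕ-injective (suc-injective (trans eq (sym eq′))))
  ParentOf-unique (inj₂ i) (inj₁ j) (inj₁ j′) eq eq′ = cong inj₁ (trans (sym eq) eq′)

  record Parent (x y : V) : Set where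
    constructor parent
    field ofView : ParentOf (view x) (view y)

  Parent-unique : ∀ {x y y′} → Parent x y → Parent x y′ → y ≡ y′
  Parent-unique {x} {y} {y′} (parent p) (parent p′) =
    view-injective (ParentOf-unique (view x) (view y) (view y′) p p′)

  open ParentGraph Parent (λ x → depthOf (view x))
    (λ {x} {y} (parent p) → depthOf-ParentOf (view x) (view y) p) Parent-unique

  Linked? : ∀ x y → Dec (Linked x y)
  Linked? x y with ParentOf? (view x) (view y) | ParentOf? (view y) (view x)
  ... | yes xy | _      = yes (to-parent (parent xy))
  ... | no  _  | yes yx = yes (to-child (parent yx))
  ... | no ¬xy | no ¬yx = no λ { (to-parent (parent xy)) → ¬xy xy ; (to-child (parent yx)) → ¬yx yx }

  adjacent : V → V → Bool
  adjacent x y = does (Linked? x y)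

  Adjacent : V → V → Set
  Adjacent x y = adjacent x y ≡ true

  Linked⇒Adjacent : ∀ {x y} → Linked x y → Adjacent x y
  Linked⇒Adjacent {x} {y} = dec-true (Linked? x y)

  Adjacent⇒Linked : ∀ {x y} → Adjacent x y → Linked x y
  Adjacent⇒Linked {x} {y} xy with Linked? x y | xy
  ... | yes xy′ | _ = xy′
  ... | no  _   | ()

  adjacent-sym : ∀ x y → adjacent x y ≡ adjacent y x
  adjacent-sym x y with Linked? x y | Linked? y x
  ... | yes _  | yes _  = refl
  ... | no  _  | no  _  = refl
  ... | yes xy | no ¬yx = ⊥-elim (¬yx (Linked-sym xy))
  ... | no ¬xy | yes yx = ⊥-elim (¬xy (Linked-sym yx))

  spine-parent : ∀ i → Parent (spine (suc i)) (spine (inject₁ i))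
  spine-parent i = parent (subst₂ ParentOf (sym (view-spine (suc i))) (sym (view-spine (inject₁ i)))
                                            (cong suc (toℕ-inject₁ i)))

  pendant-parent : ∀ j → Parent (pendant j) (spine j)
  pendant-parent j = parent (subst₂ ParentOf (sym (view-pendant j)) (sym (view-spine j)) refl)

  root : V
  root = spine zero

  spine-to-root : ∀ n (i : Fin M) → toℕ i ≡ n → Star Adjacent (spine i) root
  spine-to-root zero    zero     _  = ε
  spine-to-root (suc n) (suc i′) eq =
    Linked⇒Adjacent (to-parent (spine-parent i′))
      ◅ spine-to-root n (inject₁ i′) (trans (toℕ-inject₁ i′) (suc-injective eq))

  to-root : ∀ x → Star Adjacent x root
  to-root x with view x in eq
  ... | inj₁ i = subst (λ v → Star Adjacent v root) (view-injective {spine i} (trans (view-spine i) (sym eq)))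
                   (spine-to-root _ i refl)
  ... | inj₂ j = subst (λ v → Star Adjacent v root) (view-injective {pendant j} (trans (view-pendant j) (sym eq)))
                   (Linked⇒Adjacent (to-parent (pendant-parent j)) ◅ spine-to-root _ j refl)

  pendant-childless : ∀ s j → ¬ ParentOf s (inj₂ j)
  pendant-childless (inj₁ _) _ ()
  pendant-childless (inj₂ _) _ ()

  pendant≢spine : ∀ j i → pendant j ≢ spine i
  pendant≢spine j i eq with trans (sym (view-pendant j)) (trans (cong view eq) (view-spine i))
  ... | ()

  childKind : Fin M ⊎ Fin M → Fin 3
  childKind (inj₁ _) = suc zero
  childKind (inj₂ _) = suc (suc zero)

  neighbourKind : ∀ {x v} → Linked x v → Fin 3
  neighbourKind         (to-parent _) = zero
  neighbourKind {v = v} (to-child _)  = childKind (view v)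

  children-unique : ∀ s s′ t → ParentOf s t → ParentOf s′ t → childKind s ≡ childKind s′ → s ≡ s′
  children-unique (inj₁ i) (inj₁ i′) (inj₁ _) eq eq′ _ = cong inj₁ (toℕ-injective (trans (sym eq) eq′))
  children-unique (inj₂ i) (inj₂ i′) (inj₁ _) eq eq′ _ = cong inj₂ (trans eq (sym eq′))
  children-unique (inj₁ _) (inj₂ _)  (inj₁ _) _  _   ()
  children-unique (inj₂ _) (inj₁ _)  (inj₁ _) _  _   ()

  neighbourKind-injective : ∀ {x v v′} (l : Linked x v) (l′ : Linked x v′) →
                            neighbourKind l ≡ neighbourKind l′ → v ≡ v′
  neighbourKind-injective (to-parent xv) (to-parent xv′) _ = Parent-unique xv xv′
  neighbourKind-injective {x} {v} {v′} (to-child (parent vx)) (to-child (parent v′x)) eq =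
    view-injective (children-unique (view v) (view v′) (view x) vx v′x eq)
  neighbourKind-injective {v′ = v′} (to-parent _) (to-child _) eq with view v′
  ... | inj₁ _ = case eq of λ ()
  ... | inj₂ _ = case eq of λ ()
  neighbourKind-injective {v = v} (to-child _) (to-parent _) eq with view v
  ... | inj₁ _ = case eq of λ ()
  ... | inj₂ _ = case eq of λ ()

  neighbour-Linked : ∀ {x v} → v ∈ tabulate (adjacent x) → Linked x v
  neighbour-Linked {x} v∈ = Adjacent⇒Linked (∈-tabulate⁻ (adjacent x) v∈)

  degree≤3 : ∀ x → ∣ tabulate (adjacent x) ∣ ≤ 3
  degree≤3 x =
    injection-from⇒∣p∣≤ (tabulate (adjacent x)) (λ _ v∈ → neighbourKind (neighbour-Linked {x} v∈))
    λ v∈ v′∈ → neighbourKind-injective (neighbour-Linked {x} v∈) (neighbour-Linked {x} v′∈)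

  pendant-degree≤1 : ∀ j → ∣ tabulate (adjacent (pendant j)) ∣ ≤ 1
  pendant-degree≤1 j = injection-from⇒∣p∣≤ (tabulate (adjacent (pendant j))) (λ _ _ → zero)
    λ v∈ v′∈ _ →
      Parent-unique (parent-of-pendant (neighbour-Linked v∈)) (parent-of-pendant (neighbour-Linked v′∈))
    where
    parent-of-pendant : ∀ {v} → Linked (pendant j) v → Parent (pendant j) v
    parent-of-pendant (to-parent p) = p
    parent-of-pendant {v} (to-child (parent p)) =
      ⊥-elim (pendant-childless (view v) j (subst (ParentOf (view v)) (view-pendant j) p))

  spine-neighbour : Fin M → Fin M
  spine-neighbour zero     = suc zero
  spine-neighbour (suc i′) = inject₁ i′

  spine-neighbour-Linked : ∀ i → Linked (spine i) (spine (spine-neighbour i))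
  spine-neighbour-Linked zero     = to-child (spine-parent zero)
  spine-neighbour-Linked (suc i′) = to-parent (spine-parent i′)

  2≤spine-degree : ∀ i → 2 ≤ ∣ tabulate (adjacent (spine i)) ∣
  2≤spine-degree i = injection-into⇒≤∣p∣ (tabulate (adjacent (spine i))) neighbour neighbour-injective
    λ { zero → ∈-tabulate⁺ (adjacent (spine i)) (Linked⇒Adjacent (to-child (pendant-parent i)))
      ; (suc zero) → ∈-tabulate⁺ (adjacent (spine i)) (Linked⇒Adjacent (spine-neighbour-Linked i)) }
    where
    neighbour : Fin 2 → V
    neighbour zero       = pendant i
    neighbour (suc zero) = spine (spine-neighbour i)

    neighbour-injective : Injective _≡_ _≡_ neighbour
    neighbour-injective {zero}     {zero}     _  = refl
    neighbour-injective {suc zero} {suc zero} _  = refl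
    neighbour-injective {zero}     {suc zero} eq = ⊥-elim (pendant≢spine i _ eq)
    neighbour-injective {suc zero} {zero}     eq = ⊥-elim (pendant≢spine i _ (sym eq))

  tree : Tree
  tree = record
    { k          = M + M
    ; adj        = adjacent
    ; adj-sym    = adjacent-sym
    ; adj-irrefl = λ x xx → Linked-irrefl x (Adjacent⇒Linked xx)
    ; connected  = λ x y → to-root x ◅◅ Star.reverse (λ {a} {b} ab → trans (adjacent-sym b a) ab) (to-root y)
    ; acyclic    = λ ℓ c (c-injective , step , closing) →
                     no-cycle ℓ c c-injective (λ i → Adjacent⇒Linked (step i)) (Adjacent⇒Linked closing)
    ; maxDeg≤3   = degree≤3
    }

  leaf⇒pendant : ∀ x → Tree.Leaf tree x → ∃ λ j → x ≡ pendant j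
  leaf⇒pendant x leaf = by-view (view x) refl
    where
    by-view : ∀ s → view x ≡ s → ∃ λ j → x ≡ pendant j
    by-view (inj₂ j) eq = j , view-injective {x} {pendant j} (trans eq (sym (view-pendant j)))
    by-view (inj₁ i) eq = ⊥-elim (n≮n 1 (≤-trans (2≤spine-degree i)
      (subst (Tree.Leaf tree) (view-injective {x} {spine i} (trans eq (sym (view-spine i)))) leaf)))

  label : V → Fin M
  label x = reduce (view x)

  label-pendant : ∀ j → label (pendant j) ≡ j
  label-pendant j = cong reduce (view-pendant j)

-- Directed branch-width zero

caterpillarDecomposition : (D : Digraph) → 2 ≤ Digraph.m D → DirBranchDecomposition D
caterpillarDecomposition record { m = zero }    ()
caterpillarDecomposition record { m = suc zero } (s≤s ())
caterpillarDecomposition record { m = suc (suc M′) } _ = record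
  { T      = tree
  ; β      = label
  ; β-inj  = λ x y x-leaf y-leaf eq → pendant-injective (leaf⇒pendant x x-leaf) (leaf⇒pendant y y-leaf) eq
  ; β-surj = λ j → pendant j , pendant-degree≤1 j , label-pendant j
  }
  where
  open Caterpillar M′
  pendant-injective : ∀ {x y} → (∃ λ i → x ≡ pendant i) → (∃ λ j → y ≡ pendant j) →
                      label x ≡ label y → x ≡ y
  pendant-injective (i , refl) (j , refl) eq =
    cong pendant (trans (sym (label-pendant i)) (trans eq (label-pendant j)))

width-zero : (D : Digraph) → (∀ a b → Digraph.head D a ≢ Digraph.tail D b) →
             (B : DirBranchDecomposition D) → DirBranchDecomposition.WidthAtMost B 0
width-zero D head≢tail B _ _ _ =
  ∅ , (λ v counted → ⊥-elim (not-counted counted)) , ≤-reflexive (∣⊥∣≡0 (Digraph.n D))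
  where
  not-counted : ∀ {x y v} → DirBranchDecomposition.Counted B x y v → ⊥
  not-counted (inj₁ (a , b , head≡v , _ , tail≡v , _)) = head≢tail a b (trans head≡v (sym tail≡v))
  not-counted (inj₂ (a , b , head≡v , _ , tail≡v , _)) = head≢tail a b (trans head≡v (sym tail≡v))

dbw≡0 : (D : Digraph) → 2 ≤ Digraph.m D → (∀ a b → Digraph.head D a ≢ Digraph.tail D b) → IsDBW D 0
dbw≡0 D 2≤m head≢tail = (B , width-zero D head≢tail B) , λ _ ()
  where
  B : DirBranchDecomposition D
  B = caterpillarDecomposition D 2≤m

-- The biclique

module Biclique (N : ℕ) where
  left right : Fin N → Fin (N + N)
  left  i = i ↑ˡ N
  right j = N ↑ʳ j

  left≢right : ∀ i j → left i ≢ right j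
  left≢right i j eq with trans (sym (splitAt-↑ˡ N i N)) (trans (cong (splitAt N) eq) (splitAt-↑ʳ N N j))
  ... | ()

  remQuot-injective : Injective _≡_ _≡_ (remQuot {N} N)
  remQuot-injective {e} {e′} eq =
    trans (sym (combine-remQuot {N} N e)) (trans (cong (uncurry combine) eq) (combine-remQuot {N} N e′))

  digraph : Digraph
  digraph = record
    { n          = N + N
    ; m          = N * N
    ; tail       = λ e → left  (proj₁ (remQuot {N} N e))
    ; head       = λ e → right (proj₂ (remQuot {N} N e))
    ; loopless   = λ _ → left≢right _ _
    ; noParallel = λ _ _ tails heads →
        remQuot-injective (×-≡,≡→≡ (↑ˡ-injective N _ _ tails , ↑ʳ-injective N _ _ heads))
    }

  open Digraph digraph using (head; tail)

  head≢tail : ∀ a b → head a ≢ tail b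
  head≢tail _ _ eq = left≢right _ _ (sym eq)

  arc : Fin N → Fin N → Fin (N * N)
  arc = combine

  tail-arc : ∀ i j → tail (arc i j) ≡ left i
  tail-arc i j = cong (λ ends → left (proj₁ ends)) (remQuot-combine {N} {N} i j)

  head-arc : ∀ i j → head (arc i j) ≡ right j
  head-arc i j = cong (λ ends → right (proj₂ ends)) (remQuot-combine {N} {N} i j)

module BicliqueBranchWidth (n w : ℕ) (3w<N : 3 * w < suc (suc n)) where
  N : ℕ
  N = suc (suc n)

  open Biclique N

  w<N : w < N
  w<N = ≤-<-trans (m≤n*m w 3) 3w<N

  module _ (B : BranchDecomposition (u digraph)) (W : BranchDecomposition.WidthAtMost B w) where
    open BranchDecomposition B
    open Tree T
    open TreeProperties T
    open Graph (u digraph) using (Inc)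

    separator : ∀ {x y} → Adj x y → Subset (N + N)
    separator {x} {y} xy = proj₁ (W x y xy)

    ∣separator∣≤w : ∀ {x y} (xy : Adj x y) → ∣ separator xy ∣ ≤ w
    ∣separator∣≤w {x} {y} xy = proj₂ (proj₂ (W x y xy))

    same-side : ∀ {x y} (xy : Adj x y) {v} → v ∉ separator xy → ∀ {t₁ t₂} → Leaf t₁ → Leaf t₂ →
                Inc (τ t₁) v → Inc (τ t₂) v → ¬ ¬ ReachWithout x y t₁ t₂
    same-side {x} {y} xy {v} v∉ {t₁} {t₂} leaf₁ leaf₂ inc₁ inc₂ apart =
      v∉ (proj₁ (proj₂ (W x y xy)) v (t₁ , t₂ , leaf₁ , leaf₂ , apart , inc₁ , inc₂))

    leafOf : Fin (N * N) → Fin k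
    leafOf e = proj₁ (τ-surj e)

    leafOf-Leaf : ∀ e → Leaf (leafOf e)
    leafOf-Leaf e = proj₁ (proj₂ (τ-surj e))

    τ-leafOf : ∀ e → τ (leafOf e) ≡ e
    τ-leafOf e = proj₂ (proj₂ (τ-surj e))

    leafOf-injective : Injective _≡_ _≡_ leafOf
    leafOf-injective {e} {e′} eq = trans (sym (τ-leafOf e)) (trans (cong τ eq) (τ-leafOf e′))

    leafOf-arc-left : ∀ i j → Inc (τ (leafOf (arc i j))) (left i)
    leafOf-arc-left i j = inj₁ (trans (cong (Digraph.tail digraph) (τ-leafOf (arc i j))) (tail-arc i j))

    leafOf-arc-right : ∀ i j → Inc (τ (leafOf (arc i j))) (right j)
    leafOf-arc-right i j = inj₂ (trans (cong (Digraph.head digraph) (τ-leafOf (arc i j))) (head-arc i j))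

    Toward : Fin k → Fin k → Set
    Toward x y = Σ (Adj x y) λ xy → ∃ λ i → left i ∉ separator xy ×
                 ∃ λ t → Leaf t × Inc (τ t) (left i) × ReachWithout x y y t

    -- A right vertex j outside the separator of xy joins the leaves of the arcs (i , j) and (i′ , j).
    Toward-asym : ∀ {x y} → Toward x y → Toward y x → ⊥
    Toward-asym (xy , i , i∉ , t , leaf , inc , y⇝t) (yx , i′ , i′∉ , t′ , leaf′ , inc′ , x⇝t′)
      with ∣p∣<⇒∃∉ (separator xy) right (↑ʳ-injective N _ _) (≤-<-trans (∣separator∣≤w xy) w<N)
    ... | j , j∉ =
      same-side xy i∉ leaf (leafOf-Leaf (arc i j)) inc (leafOf-arc-left i j) λ t⇝tᵢ →
      same-side yx i′∉ leaf′ (leafOf-Leaf (arc i′ j)) inc′ (leafOf-arc-left i′ j) λ t′⇝tᵢ′ →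
      same-side xy j∉ (leafOf-Leaf (arc i j)) (leafOf-Leaf (arc i′ j))
        (leafOf-arc-right i j) (leafOf-arc-right i′ j) λ tᵢ⇝tᵢ′ →
      edge-is-bridge xy (ReachWithout-flip x⇝t′ ◅◅ ReachWithout-flip t′⇝tᵢ′ ◅◅ ReachWithout-reverse tᵢ⇝tᵢ′
                         ◅◅ ReachWithout-reverse t⇝tᵢ ◅◅ ReachWithout-reverse y⇝t)

    separatorIfAdj : ∀ y z (b : Bool) → adj y z ≡ b → Subset (N + N)
    separatorIfAdj y z true  yz = separator yz
    separatorIfAdj y z false _  = ∅

    separator⊆separatorIfAdj : ∀ {y z} b (eq : adj y z ≡ b) (yz : Adj y z) →
                               separator yz ⊆ separatorIfAdj y z b eq
    separator⊆separatorIfAdj true  eq yz v∈ =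
      subst (λ yz → _ ∈ separator yz) (Decidable⇒UIP.≡-irrelevant _≟B_ yz eq) v∈
    separator⊆separatorIfAdj false eq yz _  = case trans (sym eq) yz of λ ()

    ∣separatorIfAdj∣≤w : ∀ y z b (eq : adj y z ≡ b) → ∣ separatorIfAdj y z b eq ∣ ≤ w
    ∣separatorIfAdj∣≤w y z true  yz = ∣separator∣≤w yz
    ∣separatorIfAdj∣≤w y z false _  = ≤-trans (≤-reflexive (∣⊥∣≡0 (N + N))) z≤n

    neighbourhoodSeparator : Fin k → Subset (N + N)
    neighbourhoodSeparator y = ⋃[ tabulate (adj y) ] λ z → separatorIfAdj y z (adj y z) refl

    ∣neighbourhoodSeparator∣<N : ∀ y → ∣ neighbourhoodSeparator y ∣ < N
    ∣neighbourhoodSeparator∣<N y = ≤-<-trans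
      (≤-trans (∣⋃∣≤ w (tabulate (adj y)) _ λ z → ∣separatorIfAdj∣≤w y z (adj y z) refl)
               (*-monoˡ-≤ w (maxDeg≤3 y)))
      3w<N

    separator⊆neighbourhoodSeparator : ∀ {y z} (yz : Adj y z) → separator yz ⊆ neighbourhoodSeparator y
    separator⊆neighbourhoodSeparator {y} {z} yz v∈ =
      ∈-⋃ (tabulate (adj y)) _ (∈-tabulate⁺ (adj y) yz) (separator⊆separatorIfAdj (adj y z) refl yz v∈)

    toward-branch : ∀ {y i} → left i ∉ neighbourhoodSeparator y → ∀ {t} → t ≢ y → Leaf t → Inc (τ t) (left i) →
                    ∃ λ z → Toward y z
    toward-branch {y} {i} i∉ {t} t≢y leaf inc =
      let (z , yz , z⇝t) = in-some-branch t y t≢y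
      in z , yz , i , (λ i∈ → i∉ (separator⊆neighbourhoodSeparator yz i∈)) , t , leaf , inc , z⇝t

    -- Some left vertex i lies outside all separators at y, and one of the leaves of the arcs
    -- (i , 0) and (i , 1) differs from y.
    Toward-out : ∀ y → ¬ (∀ z → ¬ Toward y z)
    Toward-out y no-out
      with ∣p∣<⇒∃∉ (neighbourhoodSeparator y) left (↑ˡ-injective N _ _) (∣neighbourhoodSeparator∣<N y)
    ... | i , i∉ with leafOf (arc i zero) ≟F y | leafOf (arc i (suc zero)) ≟F y
    ... | no t₀≢y  | _        =
      uncurry no-out (toward-branch i∉ t₀≢y (leafOf-Leaf _) (leafOf-arc-left i zero))
    ... | yes _    | no t₁≢y  =
      uncurry no-out (toward-branch i∉ t₁≢y (leafOf-Leaf _) (leafOf-arc-left i (suc zero)))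
    ... | yes t₀≡y | yes t₁≡y
      with () ← proj₂ (combine-injective i zero i (suc zero) (leafOf-injective (trans t₀≡y (sym t₁≡y))))

    width≤w-absurd : ⊥
    width≤w-absurd = no-sinkless-orientation Toward proj₁ Toward-asym Toward-out (leafOf (arc zero zero))

  branchWidth>w : ¬ BWAtMost (u digraph) w
  branchWidth>w (B , W) = width≤w-absurd B W

mainTheorem4 : ¬ (∃ λ (f : ℕ → ℕ) → ∀ (D : Digraph) (b : ℕ) → IsDBW D b → BWAtMost (u D) (f b))
mainTheorem4 (f , bw≤f) = BicliqueBranchWidth.branchWidth>w (3 * w) w 3w<2+3w
  (bw≤f digraph 0 (dbw≡0 digraph (s≤s (s≤s z≤n)) head≢tail))
  where
  w : ℕ
  w = f 0
  3w<2+3w : 3 * w < suc (suc (3 * w))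
  3w<2+3w = m<n⇒m<1+n (n<1+n (3 * w))
  open Biclique (suc (suc (3 * w)))
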